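{- For every indexed forest $F$ and every $\rho\in\mathsf{LBS}(F)$, we have $\mathfrak{P}(F,\rho)=\mathfrak{P}_F$.
   Context: Indexed forests: for finite $S\subset\mathbb{Z}$ with maximal consecutive blocks $I_1<\cdots<I_k$, an indexed forest $F$ with support $S$ is a tuple of plane binary trees $T_j$ with $|I_j|$ nodes, canonically labeled by $I_j$ in inorder. $\operatorname{IN}(F)$ is the set of nodes, and $\mathrm{INT}(u,F)$ is the set of canonical labels of the nodes in the subtree rooted at $u$. $\rho_F(v)$ is the canonical label of the node reached from $v$ by following left children as long as possible. $\overline{\mathbb{Z}}$ is the set of symbols $(i,j)$, $i\in\mathbb{Z}$, $j\ge1$, ordered lexicographically, with $\mathrm{val}(i,j)=i$. $\mathsf{LBS}(F)$ is the set of injective maps $\rho:\operatorname{IN}(F)\to\overline{\mathbb{Z}}$ with $\rho(v)<\rho(u)$ if $v$ is the left child of $u$, $\rho(u)<\rho(v)$ if $v$ is the right child of $u$, and $\mathrm{val}(\rho(u))\in\mathrm{INT}(u,F)$ for all $u$. The polynomial $\mathfrak{P}(F,\rho)=\sum_\kappa\prod_vx_{\kappa(v)}$ is summed over $\kappa:\operatorname{IN}(F)\to\mathbb{Z}_{\ge1}$ with $\kappa(v)\le\mathrm{val}(\rho(v))$, $\kappa(\text{left child of }u)\ge\kappa(u)$, and $\kappa(\text{right child of }u)>\kappa(u)$. $\mathfrak{P}_F$ is the same sum with the bound $\kappa(v)\le\rho_F(v)$. -}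

module Defs where

open import Data.Nat as ℕ using (ℕ; zero; suc)
open import Data.Integer as ℤ using (ℤ; +_; -[1+_])
open import Data.List using (List; []; _∷_; _++_; map; concatMap; upTo; filter)
open import Data.List.Membership.Propositional using (_∈_)
open import Data.List.Relation.Unary.All using (All)
open import Data.List.Relation.Unary.Linked using (Linked)
open import Data.List.Relation.Unary.Unique.Propositional using (Unique)
import Data.List.Relation.Binary.Permutation.Propositional as PermProp
import Data.List.Relation.Binary.Permutation.Setoid as PermSetoid
open import Data.Product using (_×_; _,_; proj₁; proj₂)
open import Data.Sum using (_⊎_)
open import Data.Unit using (⊤; tt)
open import Data.Empty using (⊥)
open import Relation.Binary.PropositionalEquality using (_≡_)
open import Relation.Nullary using (Dec; yes)
open import Relation.Nullary.Decidable using (_×-dec_)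

data Tree : Set where
  leaf : Tree
  node : Tree → Tree → Tree

size : Tree → ℕ
size leaf       = 0
size (node l r) = suc (size l ℕ.+ size r)

data LTree (A : Set) : Set where
  lf : LTree A
  nd : LTree A → A → LTree A → LTree A

mapL : {A B : Set} → (A → B) → LTree A → LTree B
mapL f lf         = lf
mapL f (nd l x r) = nd (mapL f l) (f x) (mapL f r)

labels : {A : Set} → LTree A → List A
labels lf         = []
labels (nd l x r) = labels l ++ (x ∷ labels r)

-- An indexed forest is the list of its trees T_1,…,T_k, each paired with
-- the minimum a_j of its block I_j = {a_j, …, a_j + |T_j| - 1}.
-- Blocks are nonempty and are the MAXIMAL consecutive blocks of the
-- support S = I_1 ∪ … ∪ I_k, i.e. a_j + |T_j| < a_{j+1} (a gap).

record IndexedForest : Set where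
  field
    trees     : List (ℤ × Tree)
    nonempty  : All (λ p → 1 ℕ.≤ size (proj₂ p)) trees
    separated : Linked (λ p q → proj₁ p ℤ.+ + size (proj₂ p) ℤ.< proj₁ q) trees
open IndexedForest public

canon : ℤ → Tree → LTree ℤ
canon a leaf       = lf
canon a (node l r) =
  nd (canon a l) (a ℤ.+ + size l) (canon (a ℤ.+ + size l ℤ.+ + 1) r)

canonF : IndexedForest → List (LTree ℤ)
canonF F = map (λ p → canon (proj₁ p) (proj₂ p)) (trees F)

leftEnd : ℤ → LTree ℤ → ℤ
leftEnd x lf         = x
leftEnd x (nd l y r) = leftEnd y l

-- replace each label by ρ_F of that node (input: canonically labelled tree)
leftEnds : LTree ℤ → LTree ℤ
leftEnds lf         = lf
leftEnds (nd l x r) = nd (leftEnds l) (leftEnd x l) (leftEnds r)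

-- ℤ̄ : symbols (i , j) with i ∈ ℤ, j ≥ 1 (the condition j ≥ 1 is imposed
-- in LBS below), ordered lexicographically; val (i , j) = i.

Zbar : Set
Zbar = ℤ × ℕ

val : Zbar → ℤ
val = proj₁

_<̄_ : Zbar → Zbar → Set
(i , j) <̄ (i' , j') = (i ℤ.< i') ⊎ (i ≡ i' × j ℕ.< j')

-- A map ρ : IN(F) → ℤ̄ is given as a list of ℤ̄-labelled trees,
-- one per tree of F (same shape).

LeftOK : LTree Zbar → Zbar → Set
LeftOK lf         x = ⊤
LeftOK (nd _ y _) x = y <̄ x

RightOK : LTree Zbar → Zbar → Set
RightOK lf         x = ⊤
RightOK (nd _ y _) x = x <̄ y

LBSTree : LTree ℤ → LTree Zbar → Set
LBSTree lf            lf          = ⊤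
LBSTree lf            (nd _ _ _)  = ⊥
LBSTree (nd _ _ _)    lf          = ⊥
LBSTree c@(nd cl _ cr) (nd l x r) =
  LBSTree cl l × LBSTree cr r ×
  (1 ℕ.≤ proj₂ x) ×
  (val x ∈ labels c) ×               -- val(ρ(u)) ∈ INT(u,F)
  LeftOK l x × RightOK r x

LBSTrees : List (LTree ℤ) → List (LTree Zbar) → Set
LBSTrees []       []       = ⊤
LBSTrees []       (_ ∷ _)  = ⊥
LBSTrees (_ ∷ _)  []       = ⊥
LBSTrees (c ∷ cs) (t ∷ ts) = LBSTree c t × LBSTrees cs ts

_∈LBS_ : List (LTree Zbar) → IndexedForest → Set
ρ ∈LBS F = LBSTrees (canonF F) ρ × Unique (concatMap labels ρ)

-- Polynomials with ℕ-coefficients in x_1, x_2, … :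
-- a monomial ∏ x_{k} is the list of its indices (up to permutation),
-- a polynomial is a formal sum (list) of monomials (up to permutation).

Monomial : Set
Monomial = List ℕ

Poly : Set
Poly = List Monomial

module PolyEq = PermSetoid (PermProp.↭-setoid {A = ℕ})

_≈P_ : Poly → Poly → Set
_≈P_ = PolyEq._↭_

posUpTo : ℤ → List ℕ
posUpTo (+ n)    = map suc (upTo n)
posUpTo -[1+ n ] = []

candidates : LTree ℤ → List (LTree ℕ)
candidates lf         = lf ∷ []
candidates (nd l b r) =
  concatMap (λ k → concatMap (λ κl → map (λ κr → nd κl k κr) (candidates r))
                             (candidates l))
            (posUpTo b)

KLeft : LTree ℕ → ℕ → Set
KLeft lf         k = ⊤
KLeft (nd _ k' _) k = k ℕ.≤ k'

KRight : LTree ℕ → ℕ → Set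
KRight lf          k = ⊤
KRight (nd _ k' _) k = k ℕ.< k'

Compatible : LTree ℕ → Set
Compatible lf         = ⊤
Compatible (nd l k r) = Compatible l × Compatible r × KLeft l k × KRight r k

kLeft? : ∀ t k → Dec (KLeft t k)
kLeft? lf          k = yes tt
kLeft? (nd _ k' _) k = k ℕ.≤? k'

kRight? : ∀ t k → Dec (KRight t k)
kRight? lf          k = yes tt
kRight? (nd _ k' _) k = k ℕ.<? k'

compatible? : ∀ t → Dec (Compatible t)
compatible? lf         = yes tt
compatible? (nd l k r) =
  compatible? l ×-dec compatible? r ×-dec kLeft? l k ×-dec kRight? r k

polyTree : LTree ℤ → Poly
polyTree b = map labels (filter compatible? (candidates b))

-- for a forest: κ ranges over products of per-tree κ's, so the sum is the
-- product of the per-tree sums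
polyForest : List (LTree ℤ) → Poly
polyForest []       = [] ∷ []
polyForest (b ∷ bs) =
  concatMap (λ m → map (m ++_) (polyForest bs)) (polyTree b)

𝔓ρ : IndexedForest → List (LTree Zbar) → Poly
𝔓ρ F ρ = polyForest (map (mapL val) ρ)

𝔓 : IndexedForest → Poly
𝔓 F = polyForest (map leftEnds (canonF F))

-- List the κ of a tree recursively: choose the root label k, then a κ for the
-- left subtree with root ≥ k and one for the right subtree with root ≥ k + 1.
-- In the canonical forest the leftmost node of the subtree at u carries the
-- bound ρ_F(u) = min INT(u) = a, and the labels along a left chain weakly
-- increase, so no κ on that subtree has a root label above a (if u has no left
-- child, the same holds for the right subtree, whose left end is a + 1).
-- Hence raising the bound at u from a to any val(ρ(u)) ∈ INT(u) adds nothing,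
-- and induction on the tree shows that the lists of κ coincide.  Only the
-- condition val(ρ(u)) ∈ INT(u) is used.
module Submission where

open import Defs
open import Data.List using (List)

open import Data.Nat as ℕ using (ℕ; zero; suc; z≤n; s≤s)
import Data.Nat.Properties as ℕP
open import Data.Integer as ℤ using (ℤ; +_; -[1+_])
import Data.Integer.Properties as ℤP
open import Data.List using ([]; _∷_; _++_; [_]; _∷ʳ_; map; concatMap; upTo; filter)
open import Data.List.Properties
  using (filter-++; filter-≐; filter-none; concatMap-cong; concatMap-++; map-++; ++-assoc;
         ++-identityʳ; upTo-∷ʳ)
open import Data.List.Membership.Propositional using (_∈_)
open import Data.List.Relation.Unary.All as All using (All; []; _∷_)
import Data.List.Relation.Unary.All.Properties as All
open import Data.List.Relation.Unary.Any using (here)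
open import Data.Product using (_×_; _,_; proj₁; proj₂; ∃)
open import Data.Sum using (inj₁; inj₂)
open import Function using (_∘_; id; _⇔_; mk⇔; Equivalence)
open import Level using (0ℓ)
open import Relation.Nullary using (yes; no; ¬_)
open import Relation.Nullary.Decidable using (_×-dec_)
open import Relation.Unary using (Pred; Decidable)
open import Relation.Binary.PropositionalEquality
  using (_≡_; refl; sym; trans; cong; cong₂; subst; _≗_; module ≡-Reasoning)

open ≡-Reasoning
open Equivalence

module _ {A B : Set} where

  concatMap-vanishes : {f : A → List B} {xs : List A} →
                       All (λ x → f x ≡ []) xs → concatMap f xs ≡ []
  concatMap-vanishes []               = refl
  concatMap-vanishes (fx≡[] ∷ fxs≡[]) rewrite fx≡[] = concatMap-vanishes fxs≡[]

  filter-concatMap : {P : Pred B 0ℓ} (P? : Decidable P) (f : A → List B) (xs : List A) →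
                     filter P? (concatMap f xs) ≡ concatMap (filter P? ∘ f) xs
  filter-concatMap P? f []       = refl
  filter-concatMap P? f (x ∷ xs) =
    trans (filter-++ P? (f x) (concatMap f xs))
          (cong (filter P? (f x) ++_) (filter-concatMap P? f xs))

  filter-map : {P : Pred B 0ℓ} (P? : Decidable P) (f : A → B) (xs : List A) →
               filter P? (map f xs) ≡ map f (filter (P? ∘ f) xs)
  filter-map P? f []       = refl
  filter-map P? f (x ∷ xs) with P? (f x)
  ... | yes _ = cong (f x ∷_) (filter-map P? f xs)
  ... | no _  = filter-map P? f xs

  concatMap-filter : {Q : Pred A 0ℓ} (Q? : Decidable Q) {f g : A → List B} →
                     (∀ x → Q x → g x ≡ f x) → (∀ x → ¬ Q x → g x ≡ []) →
                     (xs : List A) → concatMap g xs ≡ concatMap f (filter Q? xs)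
  concatMap-filter Q? g≡f g≡[] []       = refl
  concatMap-filter Q? {g = g} g≡f g≡[] (x ∷ xs) with Q? x
  ... | yes qx = cong₂ _++_ (g≡f x qx) (concatMap-filter Q? g≡f g≡[] xs)
  ... | no ¬qx = trans (cong (_++ concatMap g xs) (g≡[] x ¬qx)) (concatMap-filter Q? g≡f g≡[] xs)

module _ {A B C : Set} {P : Pred C 0ℓ} {Q : Pred A 0ℓ} {R : Pred B 0ℓ}
         (P? : Decidable P) (Q? : Decidable Q) (R? : Decidable R) (f : A → B → C)
         (P⇔Q×R : ∀ x y → P (f x y) ⇔ (Q x × R y)) where

  filter-product : (xs : List A) (ys : List B) →
                   filter P? (concatMap (λ x → map (f x) ys) xs) ≡
                   concatMap (λ x → map (f x) (filter R? ys)) (filter Q? xs)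
  filter-product []       ys = refl
  filter-product (x ∷ xs) ys with Q? x
  ... | yes qx = trans (filter-++ P? (map (f x) ys) _) (cong₂ _++_ row (filter-product xs ys))
    where
    row : filter P? (map (f x) ys) ≡ map (f x) (filter R? ys)
    row = trans (filter-map P? (f x) ys)
                (cong (map (f x)) (filter-≐ (P? ∘ f x) R?
                  ((λ {y} p → proj₂ (to (P⇔Q×R x y) p)) , (λ {y} r → from (P⇔Q×R x y) (qx , r))) ys))
  ... | no ¬qx = trans (filter-++ P? (map (f x) ys) _) (cong₂ _++_ row (filter-product xs ys))
    where
    row : filter P? (map (f x) ys) ≡ []
    row = trans (filter-map P? (f x) ys)
                (cong (map (f x)) (filter-none (P? ∘ f x)
                  (All.universal (λ y → ¬qx ∘ proj₁ ∘ to (P⇔Q×R x y)) ys)))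

upTo-split : ∀ {p q} → p ℕ.≤ q → ∃ λ ys → upTo q ≡ upTo p ++ ys × All (p ℕ.≤_) ys
upTo-split {q = zero} z≤n = [] , refl , []
upTo-split {p} {suc q} p≤1+q with ℕP.m≤n⇒m<n∨m≡n p≤1+q
... | inj₂ refl = [] , sym (++-identityʳ (upTo (suc q))) , []
... | inj₁ (s≤s p≤q) with upTo-split p≤q
...   | ys , upTo-q≡ , p≤ys = ys ∷ʳ q , upTo-1+q≡ , All.∷ʳ⁺ p≤ys p≤q
  where
  upTo-1+q≡ : upTo (suc q) ≡ upTo p ++ ys ∷ʳ q
  upTo-1+q≡ = begin
    upTo (suc q)           ≡⟨ sym (upTo-∷ʳ q) ⟩
    upTo q ∷ʳ q            ≡⟨ cong (_∷ʳ q) upTo-q≡ ⟩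
    (upTo p ++ ys) ∷ʳ q    ≡⟨ ++-assoc (upTo p) ys [ q ] ⟩
    upTo p ++ ys ∷ʳ q      ∎

posUpTo-split : ∀ {a b} → a ℤ.≤ b →
                ∃ λ ks → posUpTo b ≡ posUpTo a ++ ks × All (λ k → a ℤ.< + k) ks
posUpTo-split { -[1+ _ ]} { -[1+ _ ]} _ = [] , refl , []
posUpTo-split { -[1+ _ ]} {+ q} ℤ.-≤+ = posUpTo (+ q) , refl , All.universal (λ _ → ℤ.-<+) _
posUpTo-split {+ p} {+ q} (ℤ.+≤+ p≤q) with upTo-split p≤q
... | ys , upTo-q≡ , p≤ys =
  map suc ys , trans (cong (map suc) upTo-q≡) (map-++ suc (upTo p) ys) ,
  All.map⁺ (All.map (ℤ.+<+ ∘ s≤s) p≤ys)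

posUpTo-bounded : ∀ b → All (λ k → + k ℤ.≤ b) (posUpTo b)
posUpTo-bounded (+ n)    = All.map⁺ (All.applyUpTo⁺₁ id n ℤ.+≤+)
posUpTo-bounded -[1+ n ] = []

concatMap-filter-posUpTo-cutoff :
  {B : Set} {Q : Pred ℕ 0ℓ} (Q? : Decidable Q) (f : ℕ → List B) {a b : ℤ} →
  a ℤ.≤ b → (∀ {k} → a ℤ.< + k → f k ≡ []) →
  concatMap f (filter Q? (posUpTo b)) ≡ concatMap f (filter Q? (posUpTo a))
concatMap-filter-posUpTo-cutoff Q? f {a} {b} a≤b vanishes with posUpTo-split a≤b
... | ks , posUpTo-b≡ , a<ks = begin
  concatMap f (filter Q? (posUpTo b))
    ≡⟨ cong (concatMap f ∘ filter Q?) posUpTo-b≡ ⟩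
  concatMap f (filter Q? (posUpTo a ++ ks))
    ≡⟨ cong (concatMap f) (filter-++ Q? (posUpTo a) ks) ⟩
  concatMap f (filter Q? (posUpTo a) ++ filter Q? ks)
    ≡⟨ concatMap-++ f (filter Q? (posUpTo a)) (filter Q? ks) ⟩
  concatMap f (filter Q? (posUpTo a)) ++ concatMap f (filter Q? ks)
    ≡⟨ cong (_ ++_) (concatMap-vanishes (All.filter⁺ Q? (All.map vanishes a<ks))) ⟩
  concatMap f (filter Q? (posUpTo a)) ++ []
    ≡⟨ ++-identityʳ _ ⟩
  concatMap f (filter Q? (posUpTo a)) ∎

RootAbove : ℕ → LTree ℕ → Set
RootAbove m κ = Compatible κ × KLeft κ m

rootAbove? : ∀ m → Decidable (RootAbove m)
rootAbove? m κ = compatible? κ ×-dec kLeft? κ m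

kLeft-zero : ∀ κ → KLeft κ 0
kLeft-zero lf         = _
kLeft-zero (nd _ _ _) = z≤n

kRight⇔kLeft-suc : ∀ κ k → KRight κ k ⇔ KLeft κ (suc k)
kRight⇔kLeft-suc lf         k = mk⇔ id id
kRight⇔kLeft-suc (nd _ _ _) k = mk⇔ id id

rootAbove-nd : ∀ m k κl κr →
               RootAbove m (nd κl k κr) ⇔ ((m ℕ.≤ k × RootAbove k κl) × RootAbove (suc k) κr)
rootAbove-nd m k κl κr = mk⇔
  (λ { ((cl , cr , kl , kr) , m≤k) → (m≤k , cl , kl) , cr , to (kRight⇔kLeft-suc κr k) kr })
  (λ { ((m≤k , cl , kl) , cr , kl′) → (cl , cr , kl , from (kRight⇔kLeft-suc κr k) kl′) , m≤k })

graft : (ℕ → List (LTree ℕ)) → (ℕ → List (LTree ℕ)) → ℕ → List (LTree ℕ)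
graft L R k = concatMap (λ κl → map (nd κl k) (R (suc k))) (L k)

graft-cong : ∀ {L L′ R R′} → L ≗ L′ → R ≗ R′ → graft L R ≗ graft L′ R′
graft-cong L≗L′ R≗R′ k =
  cong₂ (λ Lk Rk → concatMap (λ κl → map (nd κl k) Rk) Lk) (L≗L′ k) (R≗R′ (suc k))

graft-[]ˡ : ∀ L R {k} → L k ≡ [] → graft L R k ≡ []
graft-[]ˡ L R Lk≡[] = cong (concatMap _) Lk≡[]

graft-[]ʳ : ∀ L R {k} → R (suc k) ≡ [] → graft L R k ≡ []
graft-[]ʳ L R {k} R1+k≡[] =
  concatMap-vanishes (All.universal (λ κl → cong (map (nd κl k)) R1+k≡[]) (L k))

labellingsFrom : LTree ℤ → ℕ → List (LTree ℕ)
labellingsFrom lf         m = [ lf ]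
labellingsFrom (nd l b r) m =
  concatMap (graft (labellingsFrom l) (labellingsFrom r)) (filter (m ℕ.≤?_) (posUpTo b))

filter-rootAbove-candidates : ∀ b m → filter (rootAbove? m) (candidates b) ≡ labellingsFrom b m
filter-rootAbove-candidates lf         m = refl
filter-rootAbove-candidates (nd l b r) m =
  trans (filter-concatMap (rootAbove? m) nodesWithRoot (posUpTo b))
        (concatMap-filter (m ℕ.≤?_) rootAbove rootBelow (posUpTo b))
  where
  nodesWithRoot : ℕ → List (LTree ℕ)
  nodesWithRoot k = concatMap (λ κl → map (nd κl k) (candidates r)) (candidates l)

  splitRoot : ∀ k → filter (rootAbove? m) (nodesWithRoot k) ≡
              concatMap (λ κl → map (nd κl k) (filter (rootAbove? (suc k)) (candidates r)))
                        (filter (λ κl → (m ℕ.≤? k) ×-dec rootAbove? k κl) (candidates l))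
  splitRoot k = filter-product (rootAbove? m) _ (rootAbove? (suc k)) (λ κl → nd κl k)
                  (rootAbove-nd m k) (candidates l) (candidates r)

  rootAbove : ∀ k → m ℕ.≤ k → filter (rootAbove? m) (nodesWithRoot k) ≡
              graft (labellingsFrom l) (labellingsFrom r) k
  rootAbove k m≤k = trans (splitRoot k)
    (cong₂ (λ Lk R1+k → concatMap (λ κl → map (nd κl k) R1+k) Lk)
      (trans (filter-≐ _ (rootAbove? k) (proj₂ , (m≤k ,_)) (candidates l))
             (filter-rootAbove-candidates l k))
      (filter-rootAbove-candidates r (suc k)))

  rootBelow : ∀ k → ¬ m ℕ.≤ k → filter (rootAbove? m) (nodesWithRoot k) ≡ []
  rootBelow k m≰k = trans (splitRoot k)
    (cong (concatMap _) (filter-none _ (All.universal (λ _ → m≰k ∘ proj₁) (candidates l))))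

polyTree-labellingsFrom : ∀ b → polyTree b ≡ map labels (labellingsFrom b 0)
polyTree-labellingsFrom b = cong (map labels)
  (trans (filter-≐ compatible? (rootAbove? 0) ((λ {κ} c → c , kLeft-zero κ) , proj₁)
                   (candidates b))
         (filter-rootAbove-candidates b 0))

labellingsFrom-root< : ∀ l b r {m} → b ℤ.< + m → labellingsFrom (nd l b r) m ≡ []
labellingsFrom-root< l b r b<m = cong (concatMap _) (filter-none _
  (All.map (λ k≤b m≤k → ℤP.<⇒≱ b<m (ℤP.≤-trans (ℤ.+≤+ m≤k) k≤b)) (posUpTo-bounded b)))

labellingsFrom-lowerRoot : ∀ l r {a v} → a ℤ.≤ v →
  (∀ {k} → a ℤ.< + k → graft (labellingsFrom l) (labellingsFrom r) k ≡ []) →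
  labellingsFrom (nd l v r) ≗ labellingsFrom (nd l a r)
labellingsFrom-lowerRoot l r a≤v vanishes m =
  concatMap-filter-posUpTo-cutoff (m ℕ.≤?_) _ a≤v vanishes

leftEnd-canon : ∀ a T → leftEnd (a ℤ.+ + size T) (canon a T) ≡ a
leftEnd-canon a leaf         = ℤP.+-identityʳ a
leftEnd-canon a (node ll lr) = leftEnd-canon a ll

canon-lowerBound : ∀ a T → All (a ℤ.≤_) (labels (canon a T))
canon-lowerBound a leaf       = []
canon-lowerBound a (node l r) =
  All.++⁺ (canon-lowerBound a l)
          (a≤root ∷ All.map (ℤP.≤-trans (ℤP.≤-trans a≤root (ℤP.i≤i+j _ (+ 1))))
                            (canon-lowerBound _ r))
  where
  a≤root : a ℤ.≤ a ℤ.+ + size l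
  a≤root = ℤP.i≤i+j a (+ size l)

labellingsFrom-canon-beyond : ∀ a l r {k} → a ℤ.< + k →
                              labellingsFrom (leftEnds (canon a (node l r))) k ≡ []
labellingsFrom-canon-beyond a l r a<k =
  labellingsFrom-root< (leftEnds (canon a l)) _ (leftEnds (canon (a ℤ.+ + size l ℤ.+ + 1) r))
                       (subst (ℤ._< + _) (sym (leftEnd-canon a l)) a<k)

withRoot : {A : Set} → A → LTree A → LTree A
withRoot v lf         = lf
withRoot v (nd l _ r) = nd l v r

labellingsFrom-canon-lowerRoot : ∀ a l r {v} → v ∈ labels (canon a (node l r)) →
  (∀ {k} → a ℤ.< + k → graft (labellingsFrom (leftEnds (canon a l)))
                             (labellingsFrom (leftEnds (canon (a ℤ.+ + size l ℤ.+ + 1) r))) k ≡ []) →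
  labellingsFrom (withRoot v (leftEnds (canon a (node l r)))) ≗
  labellingsFrom (leftEnds (canon a (node l r)))
labellingsFrom-canon-lowerRoot a l r v∈ vanishes m =
  trans (labellingsFrom-lowerRoot (leftEnds cl) (leftEnds cr)
           (All.lookup (canon-lowerBound a (node l r)) v∈) vanishes m)
        (cong (λ b → labellingsFrom (nd (leftEnds cl) b (leftEnds cr)) m) (sym (leftEnd-canon a l)))
  where
  cl = canon a l
  cr = canon (a ℤ.+ + size l ℤ.+ + 1) r

labellingsFrom-withRoot : ∀ a l r {v} → v ∈ labels (canon a (node l r)) →
  labellingsFrom (withRoot v (leftEnds (canon a (node l r)))) ≗
  labellingsFrom (leftEnds (canon a (node l r)))
labellingsFrom-withRoot a leaf leaf (here refl) m = refl
labellingsFrom-withRoot a l@(node ll lr) r v∈ =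
  labellingsFrom-canon-lowerRoot a l r v∈ λ a<k →
    graft-[]ˡ (labellingsFrom (leftEnds (canon a l))) (labellingsFrom (leftEnds (canon _ r)))
              (labellingsFrom-canon-beyond a ll lr a<k)
labellingsFrom-withRoot a leaf r@(node rl rr) v∈ =
  labellingsFrom-canon-lowerRoot a leaf r v∈ λ a<k →
    graft-[]ʳ (labellingsFrom lf) (labellingsFrom (leftEnds (canon _ r)))
              (labellingsFrom-canon-beyond _ rl rr (1+a<1+k a<k))
  where
  1+a<1+k : ∀ {k} → a ℤ.< + k → a ℤ.+ + 0 ℤ.+ + 1 ℤ.< + suc k
  1+a<1+k a<k = subst (ℤ._< + _)
    (trans (ℤP.+-comm (+ 1) a) (cong (ℤ._+ + 1) (sym (ℤP.+-identityʳ a))))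
    (ℤP.+-monoʳ-< (+ 1) a<k)

labellingsFrom-LBS : ∀ a T t → LBSTree (canon a T) t →
                     labellingsFrom (mapL val t) ≗ labellingsFrom (leftEnds (canon a T))
labellingsFrom-LBS a leaf       lf           _                           m = refl
labellingsFrom-LBS a (node l r) (nd tl x tr) (tl-ok , tr-ok , _ , x∈ , _) m = begin
  labellingsFrom (mapL val (nd tl x tr)) m
    ≡⟨ concatMap-cong (graft-cong (labellingsFrom-LBS a l tl tl-ok)
                                  (labellingsFrom-LBS _ r tr tr-ok))
                    (filter (m ℕ.≤?_) (posUpTo (val x))) ⟩
  labellingsFrom (withRoot (val x) (leftEnds (canon a (node l r)))) m
    ≡⟨ labellingsFrom-withRoot a l r x∈ m ⟩
  labellingsFrom (leftEnds (canon a (node l r))) m ∎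

polyTree-LBS : ∀ a T t → LBSTree (canon a T) t →
               polyTree (mapL val t) ≡ polyTree (leftEnds (canon a T))
polyTree-LBS a T t t-ok = begin
  polyTree (mapL val t)
    ≡⟨ polyTree-labellingsFrom (mapL val t) ⟩
  map labels (labellingsFrom (mapL val t) 0)
    ≡⟨ cong (map labels) (labellingsFrom-LBS a T t t-ok 0) ⟩
  map labels (labellingsFrom (leftEnds (canon a T)) 0)
    ≡⟨ sym (polyTree-labellingsFrom (leftEnds (canon a T))) ⟩
  polyTree (leftEnds (canon a T)) ∎

polyForest-LBS : ∀ ts ρ → LBSTrees (map (λ p → canon (proj₁ p) (proj₂ p)) ts) ρ →
                 polyForest (map (mapL val) ρ) ≡
                 polyForest (map leftEnds (map (λ p → canon (proj₁ p) (proj₂ p)) ts))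
polyForest-LBS []             []      _            = refl
polyForest-LBS ((a , T) ∷ ts) (t ∷ ρ) (t-ok , ρ-ok) =
  cong₂ (λ p ps → concatMap (λ m → map (m ++_) ps) p)
        (polyTree-LBS a T t t-ok) (polyForest-LBS ts ρ ρ-ok)

proposition3p7 : (F : IndexedForest) (ρ : List (LTree Zbar)) →
                 ρ ∈LBS F → 𝔓ρ F ρ ≈P 𝔓 F
proposition3p7 F ρ (ρ-ok , _) = PolyEq.↭-reflexive (polyForest-LBS (trees F) ρ ρ-ok)
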